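{- The set $\{m\in\mathbb{N}: S_m(m)\equiv 1\pmod{m}\}$ equals $\{1,2,6,42,1806\}$.
   Context: $\mathbb{N}=\{1,2,3,\dots\}$. For positive integers $m,k$, $S_m(k):=1^m+2^m+\cdots+k^m$. -}

module Defs where

open import Data.Nat using (ℕ; zero; suc; _+_; _^_)

S : ℕ → ℕ → ℕ
S m zero    = 0
S m (suc k) = S m k + suc k ^ m

module Submission where

-- Let p be a prime factor of m, m = q p. Power sums are periodic mod p, so
-- S_m(m) ≡ q · S_m(p − 1) (mod p). Summing the binomial expansions of (j + 1)^E over
-- j < p shows, by strong induction on E, that p ∣ S_e(p − 1) for 0 < e < p − 1, and by
-- Fermat S_e(p − 1) mod p depends only on e mod p − 1. Hence S_m(m) ≡ 1 (mod m) forces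
-- p ∤ q and (p − 1) ∣ m. Now let m be squarefree with (p − 1) ∣ m for all p ∣ m, and
-- write m = P k with P the product of the smallest prime factors of m. The least prime
-- factor p of k has p − 1 coprime to k, so (p − 1) ∣ P, and p ∤ P. A bounded search
-- shows that for P = 1, 2, 6, 42 the only such prime is P + 1, and for P = 1806 there
-- is none.

open import Defs
open import Data.Nat
  using (ℕ; zero; suc; NonZero; _+_; _*_; _^_; _∸_; _%_; _/_; _≤_; _<_; z≤n; s≤s; _≟_; >-nonZero⁻¹; ≢-nonZero⁻¹; n>1⇒nonTrivial)
open import Data.Nat.Properties
open import Data.Nat.DivMod
open import Data.Nat.Divisibility
open import Data.Nat.Combinatorics
  using (_C_; nCn≡1; nC1≡n; nCk≡nC[n∸k]; nCk+nC[k+1]≡[n+1]C[k+1]; k>n⇒nCk≡0)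
open import Data.Nat.Coprimality using (Coprime; coprime-divisor; prime⇒coprime)
open import Data.Nat.Primality
open import Data.Nat.Induction using (<-rec)
open import Data.Product using (_×_; _,_; ∃; ∃₂; proj₁; proj₂)
open import Data.Sum using (_⊎_; inj₁; inj₂)
open import Data.Empty using (⊥-elim)
open import Function.Base using (_∘_)
open import Function.Bundles using (_⇔_; mk⇔)
open import Relation.Nullary using (¬_; yes; no; ¬?; contradiction)
open import Relation.Nullary.Decidable using (True; toWitness; _×-dec_; _→-dec_)
open import Relation.Unary using (Decidable)
open import Relation.Binary.Bundles using (Setoid)
open import Relation.Binary.PropositionalEquality
import Relation.Binary.Reasoning.Setoid as SetoidReasoning
open import Algebra.Properties.CommutativeSemigroup *-commutativeSemigroup
  using () renaming (x∙yz≈y∙xz to m*[n*o]≡n*[m*o])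
open import Algebra.Properties.CommutativeSemigroup +-commutativeSemigroup
  using () renaming (interchange to +-interchange; xy∙z≈xz∙y to [m+n]+o≡[m+o]+n; x∙yz≈y∙xz to m+[n+o]≡n+[m+o])

Σ< : ℕ → (ℕ → ℕ) → ℕ
Σ< zero    f = 0
Σ< (suc n) f = Σ< n f + f n

Σ<-cong : ∀ n {f g : ℕ → ℕ} → (∀ {i} → i < n → f i ≡ g i) → Σ< n f ≡ Σ< n g
Σ<-cong zero    eq = refl
Σ<-cong (suc n) eq = cong₂ _+_ (Σ<-cong n (eq ∘ m<n⇒m<1+n)) (eq ≤-refl)

Σ<-zero : ∀ n {f : ℕ → ℕ} → (∀ {i} → i < n → f i ≡ 0) → Σ< n f ≡ 0
Σ<-zero zero    eq = refl
Σ<-zero (suc n) eq = cong₂ _+_ (Σ<-zero n (eq ∘ m<n⇒m<1+n)) (eq ≤-refl)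

Σ<-distrib-+ : ∀ n (f g : ℕ → ℕ) → Σ< n (λ i → f i + g i) ≡ Σ< n f + Σ< n g
Σ<-distrib-+ zero    f g = refl
Σ<-distrib-+ (suc n) f g =
  trans (cong (_+ (f n + g n)) (Σ<-distrib-+ n f g)) (+-interchange (Σ< n f) (Σ< n g) (f n) (g n))

Σ<-distribˡ-* : ∀ n c (f : ℕ → ℕ) → Σ< n (λ i → c * f i) ≡ c * Σ< n f
Σ<-distribˡ-* zero    c f = sym (*-zeroʳ c)
Σ<-distribˡ-* (suc n) c f =
  trans (cong (_+ c * f n) (Σ<-distribˡ-* n c f)) (sym (*-distribˡ-+ c (Σ< n f) (f n)))

Σ<-suc : ∀ n (f : ℕ → ℕ) → Σ< (suc n) f ≡ f 0 + Σ< n (f ∘ suc)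
Σ<-suc zero    f = +-comm 0 (f 0)
Σ<-suc (suc n) f =
  trans (cong (_+ f (suc n)) (Σ<-suc n f)) (+-assoc (f 0) (Σ< n (f ∘ suc)) (f (suc n)))

[n+1]Cn≡n+1 : ∀ n → suc n C n ≡ suc n
[n+1]Cn≡n+1 n = begin
  suc n C n             ≡⟨ nCk≡nC[n∸k] (n≤1+n n) ⟩
  suc n C (1 + n ∸ n)   ≡⟨ cong (suc n C_) (m+n∸n≡m 1 n) ⟩
  suc n C 1             ≡⟨ nC1≡n (suc n) ⟩
  suc n                 ∎
  where open ≡-Reasoning

[k+1]*[n+1]C[k+1]≡[n+1]*nCk : ∀ n k → suc k * (suc n C suc k) ≡ suc n * (n C k)
[k+1]*[n+1]C[k+1]≡[n+1]*nCk zero    zero    = refl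
[k+1]*[n+1]C[k+1]≡[n+1]*nCk zero    (suc k) = *-zeroʳ (2 + k)
[k+1]*[n+1]C[k+1]≡[n+1]*nCk (suc n) zero    =
  trans (*-identityˡ _) (trans (nC1≡n (2 + n)) (sym (*-identityʳ (2 + n))))
[k+1]*[n+1]C[k+1]≡[n+1]*nCk (suc n) (suc k) = begin
  (2 + k) * (suc (suc n) C suc (suc k))
    ≡⟨ cong ((2 + k) *_) (nCk+nC[k+1]≡[n+1]C[k+1] (suc n) (suc k)) ⟨
  (2 + k) * (a + b)
    ≡⟨ *-distribˡ-+ (2 + k) a b ⟩
  a + (1 + k) * a + (2 + k) * b
    ≡⟨ cong₂ (λ u v → a + u + v)
         ([k+1]*[n+1]C[k+1]≡[n+1]*nCk n k) ([k+1]*[n+1]C[k+1]≡[n+1]*nCk n (suc k)) ⟩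
  a + (1 + n) * (n C k) + (1 + n) * (n C suc k)
    ≡⟨ +-assoc a _ _ ⟩
  a + ((1 + n) * (n C k) + (1 + n) * (n C suc k))
    ≡⟨ cong (a +_) (*-distribˡ-+ (1 + n) (n C k) (n C suc k)) ⟨
  a + (1 + n) * (n C k + n C suc k)
    ≡⟨ cong (λ c → a + (1 + n) * c) (nCk+nC[k+1]≡[n+1]C[k+1] n k) ⟩
  (2 + n) * a
    ∎
  where
  open ≡-Reasoning
  a b : ℕ
  a = suc n C suc k
  b = suc n C suc (suc k)

binomial-theorem : ∀ n x → suc x ^ n ≡ Σ< (suc n) (λ k → (n C k) * x ^ k)
binomial-theorem zero    x = refl
binomial-theorem (suc n) x = sym (begin
  Σ< (2 + n) (λ k → (suc n C k) * x ^ k)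
    ≡⟨ Σ<-suc (suc n) _ ⟩
  1 + Σ< (1 + n) (λ k → (suc n C suc k) * x ^ suc k)
    ≡⟨ cong suc (Σ<-cong (suc n) λ {k} _ →
         trans (cong (_* x ^ suc k) (sym (nCk+nC[k+1]≡[n+1]C[k+1] n k)))
               (*-distribʳ-+ (x ^ suc k) (n C k) (n C suc k))) ⟩
  1 + Σ< (1 + n) (λ k → (n C k) * x ^ suc k + (n C suc k) * x ^ suc k)
    ≡⟨ cong suc (Σ<-distrib-+ (suc n) _ _) ⟩
  1 + (Σ< (1 + n) (λ k → (n C k) * (x * x ^ k)) + B′)
    ≡⟨ cong (λ s → 1 + (s + B′)) (trans (Σ<-cong (suc n) λ {k} _ → m*[n*o]≡n*[m*o] (n C k) x (x ^ k))
                                        (Σ<-distribˡ-* (suc n) x _)) ⟩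
  1 + (x * B + B′)
    ≡⟨ m+[n+o]≡n+[m+o] 1 (x * B) B′ ⟩
  x * B + (1 + B′)
    ≡⟨ cong (x * B +_) shift ⟩
  x * B + B
    ≡⟨ +-comm (x * B) B ⟩
  suc x * B
    ≡⟨ cong (suc x *_) (binomial-theorem n x) ⟨
  suc x * suc x ^ n
    ∎)
  where
  open ≡-Reasoning
  B B′ : ℕ
  B  = Σ< (suc n) (λ k → (n C k) * x ^ k)
  B′ = Σ< (suc n) (λ k → (n C suc k) * x ^ suc k)
  shift : 1 + B′ ≡ B
  shift = begin
    1 + (Σ< n (λ k → (n C suc k) * x ^ suc k) + (n C suc n) * x ^ suc n)
      ≡⟨ cong (λ c → 1 + (Σ< n (λ k → (n C suc k) * x ^ suc k) + c * x ^ suc n)) (k>n⇒nCk≡0 (n<1+n n)) ⟩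
    1 + (Σ< n (λ k → (n C suc k) * x ^ suc k) + 0)
      ≡⟨ cong suc (+-identityʳ _) ⟩
    1 + Σ< n (λ k → (n C suc k) * x ^ suc k)
      ≡⟨ Σ<-suc n _ ⟨
    B ∎

S[0,n]≡n : ∀ n → S 0 n ≡ n
S[0,n]≡n zero    = refl
S[0,n]≡n (suc n) = trans (cong (_+ 1) (S[0,n]≡n n)) (+-comm n 1)

power-sum-recurrence : ∀ E n → 1 + Σ< E (λ k → (E C k) * S k n) ≡ suc n ^ E
power-sum-recurrence E zero =
  trans (cong suc (Σ<-zero E λ {k} _ → *-zeroʳ (E C k))) (sym (^-zeroˡ E))
power-sum-recurrence E (suc n) = begin
  1 + Σ< E (λ k → (E C k) * (S k n + suc n ^ k))
    ≡⟨ cong suc (Σ<-cong E λ {k} _ → *-distribˡ-+ (E C k) (S k n) (suc n ^ k)) ⟩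
  1 + Σ< E (λ k → (E C k) * S k n + (E C k) * suc n ^ k)
    ≡⟨ cong suc (Σ<-distrib-+ E _ _) ⟩
  1 + (Σ< E (λ k → (E C k) * S k n) + T)
    ≡⟨ +-assoc 1 _ T ⟨
  1 + Σ< E (λ k → (E C k) * S k n) + T
    ≡⟨ cong (_+ T) (power-sum-recurrence E n) ⟩
  suc n ^ E + T
    ≡⟨ +-comm (suc n ^ E) T ⟩
  T + suc n ^ E
    ≡⟨ cong (T +_) (trans (cong (_* suc n ^ E) (nCn≡1 E)) (*-identityˡ _)) ⟨
  T + (E C E) * suc n ^ E
    ≡⟨ binomial-theorem E (suc n) ⟨
  suc (suc n) ^ E
    ∎
  where
  open ≡-Reasoning
  T : ℕ
  T = Σ< E (λ k → (E C k) * suc n ^ k)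

module Congruence (d : ℕ) .{{_ : NonZero d}} where

  -- A record rather than a % d ≡ b % d, so that a and b can be found by unification.
  infix 4 _≈_
  record _≈_ (a b : ℕ) : Set where
    constructor mk≈
    field %-≡ : a % d ≡ b % d

  ≈-refl : ∀ {a} → a ≈ a
  ≈-refl = mk≈ refl

  ≈-sym : ∀ {a b} → a ≈ b → b ≈ a
  ≈-sym (mk≈ eq) = mk≈ (sym eq)

  ≈-trans : ∀ {a b c} → a ≈ b → b ≈ c → a ≈ c
  ≈-trans (mk≈ eq) (mk≈ eq′) = mk≈ (trans eq eq′)

  ≡⇒≈ : ∀ {a b} → a ≡ b → a ≈ b
  ≡⇒≈ refl = ≈-refl

  ≈-setoid : Setoid _ _
  ≈-setoid = record
    { Carrier = ℕ ; _≈_ = _≈_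
    ; isEquivalence = record { refl = ≈-refl ; sym = ≈-sym ; trans = ≈-trans } }

  module ≈-Reasoning = SetoidReasoning ≈-setoid

  +-cong : ∀ {a b c e} → a ≈ b → c ≈ e → a + c ≈ b + e
  +-cong {a} {b} {c} {e} (mk≈ eq) (mk≈ eq′) = mk≈ (begin
    (a + c) % d           ≡⟨ %-distribˡ-+ a c d ⟩
    (a % d + c % d) % d   ≡⟨ cong₂ (λ u v → (u + v) % d) eq eq′ ⟩
    (b % d + e % d) % d   ≡⟨ %-distribˡ-+ b e d ⟨
    (b + e) % d           ∎)
    where open ≡-Reasoning

  *-cong : ∀ {a b c e} → a ≈ b → c ≈ e → a * c ≈ b * e
  *-cong {a} {b} {c} {e} (mk≈ eq) (mk≈ eq′) = mk≈ (begin
    (a * c) % d             ≡⟨ %-distribˡ-* a c d ⟩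
    (a % d * (c % d)) % d   ≡⟨ cong₂ (λ u v → (u * v) % d) eq eq′ ⟩
    (b % d * (e % d)) % d   ≡⟨ %-distribˡ-* b e d ⟨
    (b * e) % d             ∎)
    where open ≡-Reasoning

  ^-congˡ : ∀ {a b} n → a ≈ b → a ^ n ≈ b ^ n
  ^-congˡ zero    eq = ≈-refl
  ^-congˡ (suc n) eq = *-cong eq (^-congˡ n eq)

  0%d≡0 : 0 % d ≡ 0
  0%d≡0 = m<n⇒m%n≡m (>-nonZero⁻¹ d)

  *-≈0ʳ : ∀ a {b} → b ≈ 0 → a * b ≈ 0
  *-≈0ʳ a b≈0 = ≈-trans (*-cong (≈-refl {a}) b≈0) (≡⇒≈ (*-zeroʳ a))

  ∣⇒≈0 : ∀ {a} → d ∣ a → a ≈ 0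
  ∣⇒≈0 {a} d∣a = mk≈ (trans (n∣m⇒m%n≡0 a d d∣a) (sym 0%d≡0))

  ≈0⇒∣ : ∀ {a} → a ≈ 0 → d ∣ a
  ≈0⇒∣ {a} (mk≈ eq) = m%n≡0⇒n∣m a d (trans eq 0%d≡0)

  d≈0 : d ≈ 0
  d≈0 = ∣⇒≈0 ∣-refl

  m+d≈m : ∀ m → m + d ≈ m
  m+d≈m m = mk≈ ([m+n]%n≡m%n m d)

  ≈⇒∣∸ : ∀ {a b} → b ≤ a → a ≈ b → d ∣ a ∸ b
  ≈⇒∣∸ {a} {b} b≤a (mk≈ eq) = divides (a / d ∸ b / d) (begin
    a ∸ b                                     ≡⟨ cong₂ _∸_ (m≡m%n+[m/n]*n a d) (m≡m%n+[m/n]*n b d) ⟩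
    (a % d + a / d * d) ∸ (b % d + b / d * d) ≡⟨ cong (λ r → (r + a / d * d) ∸ (b % d + b / d * d)) eq ⟩
    (b % d + a / d * d) ∸ (b % d + b / d * d) ≡⟨ [m+n]∸[m+o]≡n∸o (b % d) _ _ ⟩
    a / d * d ∸ b / d * d                     ≡⟨ *-distribʳ-∸ d (a / d) (b / d) ⟨
    (a / d ∸ b / d) * d                       ∎)
    where open ≡-Reasoning

  ∣∸⇒≈ : ∀ {a b} → b ≤ a → d ∣ a ∸ b → a ≈ b
  ∣∸⇒≈ {a} {b} b≤a d∣a∸b = mk≈ (begin
    a % d           ≡⟨ cong (_% d) (m∸n+n≡m b≤a) ⟨
    (a ∸ b + b) % d ≡⟨ %-remove-+ˡ b d∣a∸b ⟩
    b % d           ∎)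
    where open ≡-Reasoning

  %-≡⇒≈ : ∀ {n a b} .{{_ : NonZero n}} → d ∣ n → a % n ≡ b % n → a ≈ b
  %-≡⇒≈ {n} {a} {b} d∣n eq = mk≈ (begin
    a % d       ≡⟨ m∣n⇒o%n%m≡o%m d n a d∣n ⟨
    a % n % d   ≡⟨ cong (_% d) eq ⟩
    b % n % d   ≡⟨ m∣n⇒o%n%m≡o%m d n b d∣n ⟩
    b % d       ∎)
    where open ≡-Reasoning

  Σ<-≈0 : ∀ n {f : ℕ → ℕ} → (∀ {i} → i < n → f i ≈ 0) → Σ< n f ≈ 0
  Σ<-≈0 zero    f≈0 = ≈-refl
  Σ<-≈0 (suc n) f≈0 = +-cong (Σ<-≈0 n (f≈0 ∘ m<n⇒m<1+n)) (f≈0 ≤-refl)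

  S-cong-exponent : ∀ n {e e′} → (∀ {j} → j < n → suc j ^ e ≈ suc j ^ e′) → S e n ≈ S e′ n
  S-cong-exponent zero    eq = ≈-refl
  S-cong-exponent (suc n) eq = +-cong (S-cong-exponent n (eq ∘ m<n⇒m<1+n)) (eq ≤-refl)

  S-+-period : ∀ e n → S e (n + d) ≈ S e n + S e d
  S-+-period e zero    = ≈-refl
  S-+-period e (suc n) = begin
    S e (n + d) + suc (n + d) ^ e   ≈⟨ +-cong (S-+-period e n) (^-congˡ e (m+d≈m (suc n))) ⟩
    S e n + S e d + suc n ^ e       ≡⟨ [m+n]+o≡[m+o]+n (S e n) (S e d) (suc n ^ e) ⟩
    S e n + suc n ^ e + S e d       ∎
    where open ≈-Reasoning

  S-*-period : ∀ e q → S e (q * d) ≈ q * S e d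
  S-*-period e zero    = ≈-refl
  S-*-period e (suc q) = begin
    S e (d + q * d)         ≡⟨ cong (S e) (+-comm d (q * d)) ⟩
    S e (q * d + d)         ≈⟨ S-+-period e (q * d) ⟩
    S e (q * d) + S e d     ≈⟨ +-cong (S-*-period e q) ≈-refl ⟩
    q * S e d + S e d       ≡⟨ +-comm (q * S e d) (S e d) ⟩
    suc q * S e d           ∎
    where open ≈-Reasoning

module ModuloPrime (p-2 : ℕ) (p-prime : Prime (suc (suc p-2))) where

  p-1 p : ℕ
  p-1 = suc p-2
  p   = suc p-1

  open Congruence p

  1≉0 : ¬ (1 ≈ 0)
  1≉0 (mk≈ 1%p≡0%p) = 1+n≢0 (trans (sym (m<n⇒m%n≡m 1<p)) (trans 1%p≡0%p 0%d≡0))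
    where
    1<p : 1 < p
    1<p = s≤s (s≤s z≤n)

  p∣n*o⇒p∣o : ∀ {n o} .{{_ : NonZero n}} → n < p → p ∣ n * o → p ∣ o
  p∣n*o⇒p∣o n<p = coprime-divisor (prime⇒coprime p-prime n<p)

  p∣pC[k+1] : ∀ {k} → k < p-1 → p ∣ p C suc k
  p∣pC[k+1] {k} k<p-1 = p∣n*o⇒p∣o (s≤s k<p-1)
    (divides (p-1 C k) (trans ([k+1]*[n+1]C[k+1]≡[n+1]*nCk p-1 k) (*-comm p (p-1 C k))))

  fermat : ∀ a → a ^ p ≈ a
  fermat zero    = ≈-refl
  fermat (suc a) = begin
    suc a ^ p
      ≡⟨ binomial-theorem p a ⟩
    Σ< p f + (p C p) * a ^ p
      ≡⟨ cong₂ _+_ (Σ<-suc p-1 f) (cong (_* a ^ p) (nCn≡1 p)) ⟩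
    1 + Σ< p-1 (f ∘ suc) + 1 * a ^ p
      ≈⟨ +-cong (+-cong (≈-refl {1}) (Σ<-≈0 p-1 λ {k} k<p-1 → *-cong (∣⇒≈0 (p∣pC[k+1] k<p-1)) (≈-refl {a ^ suc k})))
                (*-cong (≈-refl {1}) (fermat a)) ⟩
    1 + 0 + 1 * a
      ≡⟨ cong suc (*-identityˡ a) ⟩
    suc a
      ∎
    where
    open ≈-Reasoning
    f : ℕ → ℕ
    f k = (p C k) * a ^ k

  p∣a*[aᵖ⁻¹∸1] : ∀ a → p ∣ a * (a ^ p-1 ∸ 1)
  p∣a*[aᵖ⁻¹∸1] zero        = p ∣0
  p∣a*[aᵖ⁻¹∸1] a@(suc _)   = subst (p ∣_) aᵖ∸a≡a*[aᵖ⁻¹∸1] (≈⇒∣∸ (m≤m*n a (a ^ p-1)) (fermat a))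
    where
    instance _ = m^n≢0 a p-1
    aᵖ∸a≡a*[aᵖ⁻¹∸1] : a ^ p ∸ a ≡ a * (a ^ p-1 ∸ 1)
    aᵖ∸a≡a*[aᵖ⁻¹∸1] = trans (cong (a ^ p ∸_) (sym (*-identityʳ a))) (sym (*-distribˡ-∸ a (a ^ p-1) 1))

  fermat-unit : ∀ {a} → p ∤ a → a ^ p-1 ≈ 1
  fermat-unit {zero}      p∤0 = contradiction (p ∣0) p∤0
  fermat-unit {a@(suc _)} p∤a with euclidsLemma a (a ^ p-1 ∸ 1) p-prime (p∣a*[aᵖ⁻¹∸1] a)
  ... | inj₁ p∣a      = contradiction p∣a p∤a
  ... | inj₂ p∣aᵖ⁻¹∸1 = ∣∸⇒≈ (m^n>0 a p-1) p∣aᵖ⁻¹∸1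

  ^≈^[%p-1] : ∀ {a} e → p ∤ a → a ^ e ≈ a ^ (e % p-1)
  ^≈^[%p-1] {a} e p∤a = begin
    a ^ e                                       ≡⟨ cong (a ^_) (m≡m%n+[m/n]*n e p-1) ⟩
    a ^ (e % p-1 + e / p-1 * p-1)               ≡⟨ ^-distribˡ-+-* a (e % p-1) _ ⟩
    a ^ (e % p-1) * a ^ (e / p-1 * p-1)         ≡⟨ cong (λ k → a ^ (e % p-1) * a ^ k) (*-comm (e / p-1) p-1) ⟩
    a ^ (e % p-1) * a ^ (p-1 * (e / p-1))       ≡⟨ cong (a ^ (e % p-1) *_) (^-*-assoc a p-1 (e / p-1)) ⟨
    a ^ (e % p-1) * (a ^ p-1) ^ (e / p-1)       ≈⟨ *-cong (≈-refl {a ^ (e % p-1)}) (^-congˡ (e / p-1) (fermat-unit p∤a)) ⟩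
    a ^ (e % p-1) * 1 ^ (e / p-1)               ≡⟨ cong (a ^ (e % p-1) *_) (^-zeroˡ (e / p-1)) ⟩
    a ^ (e % p-1) * 1                           ≡⟨ *-identityʳ _ ⟩
    a ^ (e % p-1)                               ∎
    where open ≈-Reasoning

  S≈S[%p-1] : ∀ e → S e p-1 ≈ S (e % p-1) p-1
  S≈S[%p-1] e = S-cong-exponent p-1 λ j<p-1 → ^≈^[%p-1] e (>⇒∤ (s≤s j<p-1))

  [2+e]*S[1+e]≈0 : ∀ e → (∀ {d} → d < e → S (suc d) p-1 ≈ 0) → (2 + e) * S (suc e) p-1 ≈ 0
  [2+e]*S[1+e]≈0 e vanish-below = ≈-sym (begin
    0
      ≈⟨ ≈-sym (∣⇒≈0 (m∣m*n (p ^ suc e))) ⟩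
    p ^ E
      ≡⟨ power-sum-recurrence E p-1 ⟨
    1 + Σ< E f
      ≡⟨ cong suc (Σ<-suc (suc e) f) ⟩
    1 + (f 0 + (Σ< e (f ∘ suc) + f (suc e)))
      ≈⟨ +-cong (≈-refl {1}) (+-cong (≡⇒≈ (trans (*-identityˡ _) (S[0,n]≡n p-1)))
           (+-cong (Σ<-≈0 e λ {d} d<e → *-≈0ʳ (E C suc d) (vanish-below d<e)) (≈-refl {f (suc e)}))) ⟩
    p + (0 + f (suc e))
      ≈⟨ +-cong d≈0 (≡⇒≈ (cong (_* S (suc e) p-1) ([n+1]Cn≡n+1 (suc e)))) ⟩
    0 + (2 + e) * S (suc e) p-1
      ∎)
    where
    open ≈-Reasoning
    E : ℕ
    E = 2 + e
    f : ℕ → ℕ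
    f k = (E C k) * S k p-1

  S-vanish : ∀ e → 2 + e ≤ p-1 → S (suc e) p-1 ≈ 0
  S-vanish = <-rec (λ e → 2 + e ≤ p-1 → S (suc e) p-1 ≈ 0) step
    where
    step : ∀ e → (∀ {d} → d < e → 2 + d ≤ p-1 → S (suc d) p-1 ≈ 0) → 2 + e ≤ p-1 → S (suc e) p-1 ≈ 0
    step e ih 2+e≤p-1 = ∣⇒≈0 (p∣n*o⇒p∣o (s≤s 2+e≤p-1) (≈0⇒∣ ([2+e]*S[1+e]≈0 e vanish-below)))
      where
      vanish-below : ∀ {d} → d < e → S (suc d) p-1 ≈ 0
      vanish-below d<e = ih d<e (≤-trans (s≤s (m≤n⇒m≤1+n d<e)) 2+e≤p-1)

  S≉0⇒p-1∣ : ∀ e → ¬ (S e p-1 ≈ 0) → p-1 ∣ e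
  S≉0⇒p-1∣ e S≉0 with e % p-1 in eq | S≈S[%p-1] e | m%n<n e p-1
  ... | zero  | _            | _        = m%n≡0⇒n∣m e p-1 eq
  ... | suc r | S≈S[1+r]     | 2+r≤p-1  = ⊥-elim (S≉0 (≈-trans S≈S[1+r] (S-vanish r 2+r≤p-1)))

  S[m,m]≡1⇒[p-1∣m]×[p²∤m] : ∀ m .{{_ : NonZero m}} → S m m % m ≡ 1 % m → p ∣ m →
                            p-1 ∣ m × p * p ∤ m
  S[m,m]≡1⇒[p-1∣m]×[p²∤m] m@(suc m′) S≡1 p∣m@(divides q m≡q*p) =
    S≉0⇒p-1∣ m (λ S≈0 → 1≉0 (≈-trans 1≈q*S (*-≈0ʳ q S≈0))) ,
    λ p²∣m → 1≉0 (≈-trans 1≈q*S (*-cong (∣⇒≈0 (p∣q p²∣m)) (≈-refl {S m p-1})))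
    where
    p∣q : p * p ∣ m → p ∣ q
    p∣q p²∣m = *-cancelʳ-∣ p (subst (p * p ∣_) m≡q*p p²∣m)
    1≈q*S : 1 ≈ q * S m p-1
    1≈q*S = begin
      1                   ≈⟨ %-≡⇒≈ p∣m S≡1 ⟨
      S m m               ≡⟨ cong (S m) m≡q*p ⟩
      S m (q * p)         ≈⟨ S-*-period m q ⟩
      q * S m p           ≈⟨ *-cong (≈-refl {q}) (+-cong (≈-refl {S m p-1}) (∣⇒≈0 (m∣m*n (p ^ m′)))) ⟩
      q * (S m p-1 + 0)   ≡⟨ cong (q *_) (+-identityʳ (S m p-1)) ⟩
      q * S m p-1         ∎
      where open ≈-Reasoning

PrimeDivisorCondition : ℕ → Set
PrimeDivisorCondition m = ∀ {p} → Prime p → p ∣ m → (p ∸ 1) ∣ m × p * p ∤ m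

S[m,m]≡1⇒PrimeDivisorCondition : ∀ m .{{_ : NonZero m}} → S m m % m ≡ 1 % m → PrimeDivisorCondition m
S[m,m]≡1⇒PrimeDivisorCondition m S≡1 {suc (suc p-2)} p-prime =
  ModuloPrime.S[m,m]≡1⇒[p-1∣m]×[p²∤m] p-2 p-prime m S≡1

Admissible : ℕ → ℕ → Set
Admissible P p = (p ∸ 1) ∣ P × p ∤ P × Prime p

-- The cheap divisibility tests come first, so that the bounded searches below stay fast.
admissible? : ∀ P → Decidable (Admissible P)
admissible? P p = (p ∸ 1) ∣? P ×-dec ¬? (p ∣? P) ×-dec prime? p

admissible⇒<2+ : ∀ {P p} .{{_ : NonZero P}} → Admissible P p → p < 2 + P
admissible⇒<2+ {p = zero}  _           = s≤s z≤n
admissible⇒<2+ {p = suc p} (p∣P , _)   = s≤s (s≤s (∣⇒≤ p∣P))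

admissible⇒-by-search : ∀ P .{{_ : NonZero P}} {Q : ℕ → Set} (Q? : Decidable Q) →
                        True (allUpTo? (λ p → admissible? P p →-dec Q? p) (2 + P)) →
                        ∀ {p} → Admissible P p → Q p
admissible⇒-by-search P Q? search adm = toWitness search (admissible⇒<2+ adm) adm

admissible[1] : ∀ {p} → Admissible 1 p → p ≡ 2
admissible[1] = admissible⇒-by-search 1 (_≟ 2) _

admissible[2] : ∀ {p} → Admissible 2 p → p ≡ 3
admissible[2] = admissible⇒-by-search 2 (_≟ 3) _

admissible[6] : ∀ {p} → Admissible 6 p → p ≡ 7
admissible[6] = admissible⇒-by-search 6 (_≟ 7) _

admissible[42] : ∀ {p} → Admissible 42 p → p ≡ 43
admissible[42] = admissible⇒-by-search 42 (_≟ 43) _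

¬admissible[1806] : ∀ {p} → ¬ Admissible 1806 p
¬admissible[1806] = admissible⇒-by-search 1806 (λ _ → no λ ()) _

least-divisor-from : ∀ k d fuel → d + fuel ≡ k → d Rough k → ∃ λ p → d ≤ p × p ∣ k × p Rough k
least-divisor-from k d zero    d+0≡k d-rough =
  d , ≤-refl , subst (d ∣_) (trans (sym (+-identityʳ d)) d+0≡k) ∣-refl , d-rough
least-divisor-from k d (suc f) d+f≡k d-rough with d ∣? k
... | yes d∣k = d , ≤-refl , d∣k , d-rough
... | no  d∤k with least-divisor-from k (suc d) f (trans (sym (+-suc d f)) d+f≡k) (∤⇒rough-suc d∤k d-rough)
...   | p , d<p , p∣k , p-rough = p , <⇒≤ d<p , p∣k , p-rough

least-prime-factor : ∀ k → 2 ≤ k → ∃ λ p → Prime p × p ∣ k × p Rough k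
least-prime-factor k 2≤k with least-divisor-from k 2 (k ∸ 2) (m+[n∸m]≡n 2≤k) 2-rough
... | p , 2≤p , p∣k , p-rough = p , rough∧∣⇒prime {{n>1⇒nonTrivial 2≤p}} p-rough p∣k , p∣k , p-rough

rough⇒Coprime[p∸1] : ∀ {p k} .{{_ : NonZero k}} → Prime p → p Rough k → Coprime (p ∸ 1) k
rough⇒Coprime[p∸1] {suc (suc _)} {k} _ _ {zero} (_ , 0∣k) = ⊥-elim (≢-nonZero⁻¹ k (0∣⇒≡0 0∣k))
rough⇒Coprime[p∸1] {suc (suc _)} _ _ {suc zero} _ = refl
rough⇒Coprime[p∸1] {suc (suc _)} _ p-rough {suc (suc _)} (i∣p-1 , i∣k) =
  ⊥-elim (p-rough (hasNonTrivialDivisor (s≤s (∣⇒≤ i∣p-1)) i∣k))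

module Classification (m : ℕ) .{{_ : NonZero m}} (condition : PrimeDivisorCondition m) where

  next-admissible : ∀ {P k} → m ≡ P * k → k ≡ 1 ⊎ ∃₂ λ p k′ → Admissible P p × m ≡ P * p * k′
  next-admissible {P} {zero}  m≡P*0 = ⊥-elim (≢-nonZero⁻¹ m (trans m≡P*0 (*-zeroʳ P)))
  next-admissible {P} {suc zero} _ = inj₁ refl
  next-admissible {P} {k@(suc (suc _))} m≡P*k with least-prime-factor k (s≤s (s≤s z≤n))
  ... | p , p-prime , p∣k@(divides k′ k≡k′*p) , p-rough =
        inj₂ (p , k′ , (p-1∣P , p∤P , p-prime) , m≡P*p*k′)
    where
    m≡k*P : m ≡ k * P
    m≡k*P = trans m≡P*k (*-comm P k)
    p∣m : p ∣ m
    p∣m = ∣-trans p∣k (divides P m≡P*k)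
    p-1∣P : (p ∸ 1) ∣ P
    p-1∣P = coprime-divisor (rough⇒Coprime[p∸1] p-prime p-rough)
              (subst ((p ∸ 1) ∣_) m≡k*P (proj₁ (condition p-prime p∣m)))
    p∤P : p ∤ P
    p∤P p∣P = proj₂ (condition p-prime p∣m) (subst (p * p ∣_) (sym m≡P*k) (*-pres-∣ p∣P p∣k))
    m≡P*p*k′ : m ≡ P * p * k′
    m≡P*p*k′ = begin
      m              ≡⟨ m≡P*k ⟩
      P * k          ≡⟨ cong (P *_) (trans k≡k′*p (*-comm k′ p)) ⟩
      P * (p * k′)   ≡⟨ *-assoc P p k′ ⟨
      P * p * k′     ∎
      where open ≡-Reasoning

  next : ∀ {P k} → m ≡ P * k → (∀ {p} → Admissible P p → p ≡ suc P) →
         k ≡ 1 ⊎ ∃ λ k′ → m ≡ P * suc P * k′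
  next m≡P*k unique with next-admissible m≡P*k
  ... | inj₁ k≡1 = inj₁ k≡1
  ... | inj₂ (p , k′ , adm , m≡P*p*k′) rewrite unique adm = inj₂ (k′ , m≡P*p*k′)

  classify : m ≡ 1 ⊎ m ≡ 2 ⊎ m ≡ 6 ⊎ m ≡ 42 ⊎ m ≡ 1806
  classify with next {k = m} (sym (*-identityˡ m)) admissible[1]
  ... | inj₁ m≡1 = inj₁ m≡1
  ... | inj₂ (k₁ , m≡2*k₁) with next {k = k₁} m≡2*k₁ admissible[2]
  ... | inj₁ refl = inj₂ (inj₁ m≡2*k₁)
  ... | inj₂ (k₂ , m≡6*k₂) with next {k = k₂} m≡6*k₂ admissible[6]
  ... | inj₁ refl = inj₂ (inj₂ (inj₁ m≡6*k₂))
  ... | inj₂ (k₃ , m≡42*k₃) with next {k = k₃} m≡42*k₃ admissible[42]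
  ... | inj₁ refl = inj₂ (inj₂ (inj₂ (inj₁ m≡42*k₃)))
  ... | inj₂ (k₄ , m≡1806*k₄) with next-admissible {k = k₄} m≡1806*k₄
  ... | inj₁ refl = inj₂ (inj₂ (inj₂ (inj₂ m≡1806*k₄)))
  ... | inj₂ (_ , _ , adm , _) = ⊥-elim (¬admissible[1806] adm)

proposition1 : (m : ℕ) → .{{_ : NonZero m}} →
    ((S m m % m ≡ 1 % m) ⇔ (m ≡ 1 ⊎ m ≡ 2 ⊎ m ≡ 6 ⊎ m ≡ 42 ⊎ m ≡ 1806))
proposition1 m = mk⇔ (λ S≡1 → Classification.classify m (S[m,m]≡1⇒PrimeDivisorCondition m S≡1)) converse
  where
  converse : m ≡ 1 ⊎ m ≡ 2 ⊎ m ≡ 6 ⊎ m ≡ 42 ⊎ m ≡ 1806 → S m m % m ≡ 1 % m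
  converse (inj₁ refl)                         = refl
  converse (inj₂ (inj₁ refl))                  = refl
  converse (inj₂ (inj₂ (inj₁ refl)))           = refl
  converse (inj₂ (inj₂ (inj₂ (inj₁ refl))))    = refl
  converse (inj₂ (inj₂ (inj₂ (inj₂ refl))))    = refl
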